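{- For positive integers $M$ and $\ell$, $$r^{(M)}(\ell^2)=\#\Big\{(a,n)\in\mathbb{Z}_{>0}^2:\ a\mid n^2,\ \gcd(n,M)=1,\ a+\tfrac{n^2}{a}=\ell\Big\}+\begin{cases}1&M=1,\\0&M>1.\end{cases}$$
   Context: For positive integers $M$ and $D$, $r^{(M)}(D)=\tfrac12\#\{(x,y)\in\mathbb{Z}^2:D=x^2+4y^2,\ \gcd(y,M)=1\}$. -}

module Defs where

open import Data.Nat using (ℕ; zero; suc; _+_; _*_; _<_; _/_; NonZero; >-nonZero)
open import Data.Nat.Divisibility using (_∣_)
open import Data.Nat.GCD using (gcd)
open import Data.Integer as ℤ using (ℤ; +_; ∣_∣)
open import Data.Fin using (Fin)
open import Data.Product using (Σ; _×_)
open import Function.Bundles using (_↔_)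
open import Relation.Binary.PropositionalEquality using (_≡_)
open import Relation.Nullary using (Dec; yes; no)
open import Data.Nat using (_≟_)

HasSize : ∀ {a} → Set a → ℕ → Set a
HasSize A k = A ↔ Fin k

-- Points (x,y) ∈ ℤ² with D = x² + 4y² and gcd(y,M) = 1.
-- r^{(M)}(D) is half the number of such points.
RPoint : ℕ → ℕ → Set
RPoint M D = Σ (ℤ × ℤ) λ p →
  let x = Data.Product.proj₁ p ; y = Data.Product.proj₂ p in
  (+ D ≡ x ℤ.* x ℤ.+ (+ 4) ℤ.* (y ℤ.* y)) × (gcd ∣ y ∣ M ≡ 1)

APoint : ℕ → ℕ → Set
APoint M ℓ = Σ (ℕ × ℕ) λ p →
  let a = Data.Product.proj₁ p ; n = Data.Product.proj₂ p in
  Σ (0 < a) λ a>0 → (0 < n) × (a ∣ n * n) × (gcd n M ≡ 1)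
    × (a + _/_ (n * n) a {{>-nonZero a>0}} ≡ ℓ)

δ₁ : ℕ → ℕ
δ₁ M with M ≟ 1
... | yes _ = 1
... | no _ = 0

module Submission where

-- Write a point of RPoint M (ℓ²) as (x, y), so ℓ² = x² + 4y².
-- On the axis y = 0 the coprimality condition reads gcd(0, M) = M = 1, and then
-- the points are exactly x = ±ℓ: this contributes 2·δ₁ M.  The points with
-- y = ±n, n > 0, come in two copies (one per sign of y) of the set of pairs
-- (n, x) with ℓ² = x² + 4n² and gcd(n, M) = 1.
-- The heart of the proof is the correspondence between integer roots x of
-- ℓ² = x² + 4m and splittings ℓ = a + q with a·q = m, via x = q − a: one
-- direction is the identity (a + q)² = (q − a)² + 4aq, the other writes
-- ℓ = |x| + 2a after a parity argument, and the splitting is determined by x.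
-- For m = n² > 0 the splittings are exactly the divisors a of n² with
-- a + n²/a = ℓ, so the off-axis points (up to the sign of y) are in bijection
-- with APoint M ℓ.  Finally APoint M ℓ is a decidable, proof-irrelevant subset
-- of the box [0, ℓ] × [0, ℓ²], hence finite; its size is the N of the theorem.

open import Defs
open import Data.Nat using (ℕ; zero; suc; pred; _+_; _*_; _∸_; _/_; _≤_; _<_; z≤n; s≤s; >-nonZero; _≟_; _<?_)
open import Data.Nat.Properties
  using (≡-irrelevant; <-irrelevant; *-cancelʳ-≡; *-cancelˡ-≡; +-cancelˡ-≡; +-comm; *-comm; +-identityʳ; m≤m+n; m≤n+m; m≤m*n;
         *-mono-<; *-mono-≤; <⇒≱; ≮⇒≥; ≤-antisym; ≤-reflexive; ≤-trans; m+[n∸m]≡n)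
open import Data.Nat.Divisibility using (_∣_; divides; quotient; _∣?_; m∣m*n; ∣m+n∣m⇒∣n; n/m≡quotient)
open import Data.Nat.DivMod using (m*[n/m]≡n)
open import Data.Nat.GCD using (gcd; gcd-identityˡ)
open import Data.Nat.Primality using (euclidsLemma; prime[2])
import Data.Nat.Solver as ℕ-Solver
open import Data.Integer as ℤ using (ℤ; +_; -[1+_]; +[1+_]; ∣_∣)
open import Data.Integer.Properties as ℤP using (pos-*; pos-+)
import Data.Integer.Solver as ℤ-Solver
open import Data.Fin using (Fin; zero; suc; toℕ; fromℕ<)
open import Data.Fin.Properties using (+↔⊎; *↔×; fromℕ<-toℕ; toℕ-fromℕ<)
open import Data.Product using (Σ; _×_; _,_; proj₁; proj₂; map)
open import Data.Product.Function.Dependent.Propositional using (Σ-↔)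
open import Data.Sum using (_⊎_; inj₁; inj₂; [_,_]′)
open import Data.Sum.Function.Propositional using (_⊎-↔_)
open import Data.Empty using (⊥-elim)
open import Function using (_∘_; id)
open import Function.Bundles using (_↔_; mk↔ₛ′)
open import Function.Properties.Inverse using (↔-sym; ↔-trans; ↔-refl)
open import Relation.Binary.PropositionalEquality
  using (_≡_; refl; sym; trans; cong; cong₂; subst; module ≡-Reasoning)
open import Relation.Nullary using (Dec; yes; no; Irrelevant)
open import Relation.Nullary.Decidable using (_×-dec_; map′)
open import Axiom.UniquenessOfIdentityProofs using (module Decidable⇒UIP)

IrrelevantPred : {A : Set} → (A → Set) → Set
IrrelevantPred P = ∀ x → Irrelevant (P x)

subset-≡ : {A : Set} {P : A → Set} → IrrelevantPred P →
           {s t : Σ A P} → proj₁ s ≡ proj₁ t → s ≡ t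
subset-≡ irr {x , p} {.x , p′} refl = cong (x ,_) (irr x p p′)

subset-↔ : {A B : Set} {P : A → Set} {Q : B → Set} → IrrelevantPred P → IrrelevantPred Q →
           (to : Σ A P → Σ B Q) (from : Σ B Q → Σ A P) →
           (∀ s → proj₁ (from (to s)) ≡ proj₁ s) → (∀ t → proj₁ (to (from t)) ≡ proj₁ t) →
           Σ A P ↔ Σ B Q
subset-↔ irrP irrQ to from from∘to to∘from =
  mk↔ₛ′ to from (subset-≡ irrQ ∘ to∘from) (subset-≡ irrP ∘ from∘to)

dec-size : {P : Set} → Dec P → ℕ
dec-size (yes _) = 1
dec-size (no _)  = 0

dec-↔ : {P : Set} → Irrelevant P → (d : Dec P) → P ↔ Fin (dec-size d)
dec-↔ irr (yes p) = mk↔ₛ′ (λ _ → zero) (λ _ → p) (λ { zero → refl }) (irr p)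
dec-↔ irr (no ¬p) = mk↔ₛ′ (⊥-elim ∘ ¬p) (λ ()) (λ ()) (⊥-elim ∘ ¬p)

Σ-Fin-suc : ∀ {k} {P : Fin (suc k) → Set} → Σ (Fin (suc k)) P ↔ (P zero ⊎ Σ (Fin k) (P ∘ suc))
Σ-Fin-suc {k} {P} = mk↔ₛ′ to from to∘from from∘to
  where
  to : Σ (Fin (suc k)) P → P zero ⊎ Σ (Fin k) (P ∘ suc)
  to (zero  , p) = inj₁ p
  to (suc i , p) = inj₂ (i , p)
  from : P zero ⊎ Σ (Fin k) (P ∘ suc) → Σ (Fin (suc k)) P
  from (inj₁ p)       = zero , p
  from (inj₂ (i , p)) = suc i , p
  to∘from : ∀ y → to (from y) ≡ y
  to∘from (inj₁ _) = refl
  to∘from (inj₂ _) = refl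
  from∘to : ∀ x → from (to x) ≡ x
  from∘to (zero  , _) = refl
  from∘to (suc _ , _) = refl

count : ∀ k {P : Fin k → Set} → (∀ i → Dec (P i)) → ℕ
count zero    d = 0
count (suc k) d = dec-size (d zero) + count k (d ∘ suc)

count-↔ : ∀ k {P : Fin k → Set} → IrrelevantPred P → (d : ∀ i → Dec (P i)) →
          Σ (Fin k) P ↔ Fin (count k d)
count-↔ zero    irr d = mk↔ₛ′ (λ { (() , _) }) (λ ()) (λ ()) (λ { (() , _) })
count-↔ (suc k) irr d =
  ↔-trans Σ-Fin-suc (↔-trans (dec-↔ (irr zero) (d zero) ⊎-↔ count-↔ k (irr ∘ suc) (d ∘ suc)) (↔-sym +↔⊎))

box-↔ : {P : ℕ × ℕ → Set} (B₁ B₂ : ℕ) → IrrelevantPred P →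
        (∀ {a n} → P (a , n) → a < B₁ × n < B₂) →
        Σ (ℕ × ℕ) P ↔ Σ (Fin B₁ × Fin B₂) (P ∘ map toℕ toℕ)
box-↔ {P} B₁ B₂ irr bound = subset-↔ irr (irr ∘ map toℕ toℕ) to from from∘to to∘from
  where
  to : Σ (ℕ × ℕ) P → Σ (Fin B₁ × Fin B₂) (P ∘ map toℕ toℕ)
  to ((a , n) , p) = (fromℕ< a<B₁ , fromℕ< n<B₂) ,
                     subst P (sym (cong₂ _,_ (toℕ-fromℕ< a<B₁) (toℕ-fromℕ< n<B₂))) p
    where a<B₁ = proj₁ (bound p) ; n<B₂ = proj₂ (bound p)
  from : Σ (Fin B₁ × Fin B₂) (P ∘ map toℕ toℕ) → Σ (ℕ × ℕ) P
  from (ij , p) = map toℕ toℕ ij , p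
  from∘to : ∀ s → proj₁ (from (to s)) ≡ proj₁ s
  from∘to ((a , n) , p) = cong₂ _,_ (toℕ-fromℕ< _) (toℕ-fromℕ< _)
  to∘from : ∀ t → proj₁ (to (from t)) ≡ proj₁ t
  to∘from ((i , j) , p) = cong₂ _,_ (fromℕ<-toℕ i _) (fromℕ<-toℕ j _)

box-finite : {P : ℕ × ℕ → Set} (B₁ B₂ : ℕ) → IrrelevantPred P → (∀ x → Dec (P x)) →
             (∀ {a n} → P (a , n) → a < B₁ × n < B₂) → Σ ℕ (HasSize (Σ (ℕ × ℕ) P))
box-finite B₁ B₂ irr dec bound =
  _ , ↔-trans (box-↔ B₁ B₂ irr bound)
        (↔-trans (↔-sym (Σ-↔ (*↔× {B₁} {B₂}) ↔-refl)) (count-↔ (B₁ * B₂) (λ _ → irr _) (λ _ → dec _)))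

square-≤⁻¹ : ∀ {m n} → m * m ≤ n * n → m ≤ n
square-≤⁻¹ sq = ≮⇒≥ (λ n<m → <⇒≱ (*-mono-< n<m n<m) sq)

square-injective : ∀ {m n} → m * m ≡ n * n → m ≡ n
square-injective eq = ≤-antisym (square-≤⁻¹ (≤-reflexive eq)) (square-≤⁻¹ (≤-reflexive (sym eq)))

half-gap : ∀ ℓ s m → ℓ * ℓ ≡ s * s + 4 * m → Σ ℕ λ a → (s + 2 * a ≡ ℓ) × (a * (s + a) ≡ m)
half-gap ℓ s m eq = a , s+2a≡ℓ , a[s+a]≡m
  where
  open ≡-Reasoning
  square-of-sum : ∀ s d → s * s + d * (d + 2 * s) ≡ (s + d) * (s + d)
  square-of-sum = solve 2 (λ s d → s :* s :+ d :* (d :+ con 2 :* s) := (s :+ d) :* (s :+ d)) refl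
    where open ℕ-Solver.+-*-Solver
  quadruple : ∀ a s → 4 * (a * (s + a)) ≡ (2 * a) * (2 * a + 2 * s)
  quadruple = solve 2 (λ a s → con 4 :* (a :* (s :+ a)) := (con 2 :* a) :* (con 2 :* a :+ con 2 :* s)) refl
    where open ℕ-Solver.+-*-Solver
  four-times : ∀ m → 4 * m ≡ 2 * m * 2
  four-times = solve 1 (λ m → con 4 :* m := con 2 :* m :* con 2) refl
    where open ℕ-Solver.+-*-Solver
  d : ℕ
  d = ℓ ∸ s
  s+d≡ℓ : s + d ≡ ℓ
  s+d≡ℓ = m+[n∸m]≡n {s} (square-≤⁻¹ (subst (s * s ≤_) (sym eq) (m≤m+n (s * s) (4 * m))))
  gap : d * (d + 2 * s) ≡ 4 * m
  gap = +-cancelˡ-≡ (s * s) _ _ (begin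
    s * s + d * (d + 2 * s) ≡⟨ square-of-sum s d ⟩
    (s + d) * (s + d)       ≡⟨ cong (λ l → l * l) s+d≡ℓ ⟩
    ℓ * ℓ                   ≡⟨ eq ⟩
    s * s + 4 * m           ∎)
  -- d·(d + 2s) is even, and d + 2s ≡ d (mod 2), so d is even.
  2∣d : 2 ∣ d
  2∣d = [ id , (λ 2∣d+2s → ∣m+n∣m⇒∣n (subst (2 ∣_) (+-comm d (2 * s)) 2∣d+2s) (m∣m*n s)) ]′
          (euclidsLemma d (d + 2 * s) prime[2] (subst (2 ∣_) (sym gap) (divides (2 * m) (four-times m))))
  a : ℕ
  a = quotient 2∣d
  d≡2a : d ≡ 2 * a
  d≡2a = trans (_∣_.equality 2∣d) (*-comm a 2)
  s+2a≡ℓ : s + 2 * a ≡ ℓ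
  s+2a≡ℓ = trans (cong (λ e → s + e) (sym d≡2a)) s+d≡ℓ
  a[s+a]≡m : a * (s + a) ≡ m
  a[s+a]≡m = *-cancelˡ-≡ _ _ 4 (begin
    4 * (a * (s + a))             ≡⟨ quadruple a s ⟩
    (2 * a) * (2 * a + 2 * s)     ≡⟨ cong (λ e → e * (e + 2 * s)) (sym d≡2a) ⟩
    d * (d + 2 * s)               ≡⟨ gap ⟩
    4 * m                         ∎)

Root : ℕ → ℕ → ℤ → Set
Root ℓ m x = + (ℓ * ℓ) ≡ x ℤ.* x ℤ.+ + 4 ℤ.* + m

record Splits (ℓ m a q : ℕ) : Set where
  constructor splitting
  field
    sum     : a + q ≡ ℓ
    product : a * q ≡ m

root-gcd-irrelevant : {i j : ℤ} {c d : ℕ} → Irrelevant ((i ≡ j) × (c ≡ d))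
root-gcd-irrelevant (r , g) (r′ , g′) =
  cong₂ _,_ (Decidable⇒UIP.≡-irrelevant ℤ._≟_ r r′) (≡-irrelevant g g′)

square-abs : ∀ x → x ℤ.* x ≡ + (∣ x ∣ * ∣ x ∣)
square-abs (+ s)    = sym (pos-* s s)
square-abs -[1+ t ] = refl

root-abs : ∀ {ℓ m} x → Root ℓ m x → ℓ * ℓ ≡ ∣ x ∣ * ∣ x ∣ + 4 * m
root-abs {ℓ} {m} x r = ℤP.+-injective (begin
  + (ℓ * ℓ)                           ≡⟨ r ⟩
  x ℤ.* x ℤ.+ + 4 ℤ.* + m             ≡⟨ cong₂ ℤ._+_ (square-abs x) (sym (pos-* 4 m)) ⟩
  + (∣ x ∣ * ∣ x ∣) ℤ.+ + (4 * m)     ≡⟨ sym (pos-+ (∣ x ∣ * ∣ x ∣) (4 * m)) ⟩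
  + (∣ x ∣ * ∣ x ∣ + 4 * m)           ∎)
  where open ≡-Reasoning

splits⇒root : ∀ {ℓ m a q} → Splits ℓ m a q → Root ℓ m (+ q ℤ.- + a)
splits⇒root {ℓ} {m} {a} {q} (splitting sum product) = begin
  + (ℓ * ℓ)                                         ≡⟨ cong (λ l → + (l * l)) (sym sum) ⟩
  + ((a + q) * (a + q))                             ≡⟨ pos-* (a + q) (a + q) ⟩
  + (a + q) ℤ.* + (a + q)                           ≡⟨ cong (λ z → z ℤ.* z) (pos-+ a q) ⟩
  (+ a ℤ.+ + q) ℤ.* (+ a ℤ.+ + q)                   ≡⟨ sum-square (+ a) (+ q) ⟩
  (+ q ℤ.- + a) ℤ.* (+ q ℤ.- + a) ℤ.+ + 4 ℤ.* (+ a ℤ.* + q)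
    ≡⟨ cong (λ z → (+ q ℤ.- + a) ℤ.* (+ q ℤ.- + a) ℤ.+ + 4 ℤ.* z) (trans (sym (pos-* a q)) (cong +_ product)) ⟩
  (+ q ℤ.- + a) ℤ.* (+ q ℤ.- + a) ℤ.+ + 4 ℤ.* + m   ∎
  where
  open ≡-Reasoning
  sum-square : ∀ (a q : ℤ) → (a ℤ.+ q) ℤ.* (a ℤ.+ q) ≡ (q ℤ.- a) ℤ.* (q ℤ.- a) ℤ.+ + 4 ℤ.* (a ℤ.* q)
  sum-square = solve 2 (λ a q → (a :+ q) :* (a :+ q) := (q :- a) :* (q :- a) :+ con (+ 4) :* (a :* q)) refl
    where open ℤ-Solver.+-*-Solver

-- Every root arises in this way: for x = ±s, ℓ = s + 2a splits as a + (s + a).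
root⇒splits : ∀ {ℓ m} x → Root ℓ m x → Σ (ℕ × ℕ) λ (a , q) → Splits ℓ m a q × (+ q ℤ.- + a ≡ x)
root⇒splits {ℓ} {m} (+ s) r = positive (half-gap ℓ s m (root-abs {ℓ} {m} (+ s) r))
  where
  parts : ∀ a s → a + (s + a) ≡ s + 2 * a
  parts = solve 2 (λ a s → a :+ (s :+ a) := s :+ con 2 :* a) refl
    where open ℕ-Solver.+-*-Solver
  add-sub : ∀ (s a : ℤ) → (s ℤ.+ a) ℤ.- a ≡ s
  add-sub = solve 2 (λ s a → (s :+ a) :- a := s) refl
    where open ℤ-Solver.+-*-Solver
  positive : Σ ℕ (λ a → (s + 2 * a ≡ ℓ) × (a * (s + a) ≡ m)) →
             Σ (ℕ × ℕ) λ (a , q) → Splits ℓ m a q × (+ q ℤ.- + a ≡ + s)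
  positive (a , s+2a≡ℓ , a[s+a]≡m) =
    (a , s + a) , splitting (trans (parts a s) s+2a≡ℓ) a[s+a]≡m ,
    trans (cong (ℤ._- + a) (pos-+ s a)) (add-sub (+ s) (+ a))
root⇒splits {ℓ} {m} -[1+ t ] r = negative (half-gap ℓ (suc t) m (root-abs {ℓ} {m} -[1+ t ] r))
  where
  parts : ∀ a s → (s + a) + a ≡ s + 2 * a
  parts = solve 2 (λ a s → (s :+ a) :+ a := s :+ con 2 :* a) refl
    where open ℕ-Solver.+-*-Solver
  sub-add : ∀ (s a : ℤ) → a ℤ.- (s ℤ.+ a) ≡ ℤ.- s
  sub-add = solve 2 (λ s a → a :- (s :+ a) := :- s) refl
    where open ℤ-Solver.+-*-Solver
  negative : Σ ℕ (λ a → (suc t + 2 * a ≡ ℓ) × (a * (suc t + a) ≡ m)) →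
             Σ (ℕ × ℕ) λ (a , q) → Splits ℓ m a q × (+ q ℤ.- + a ≡ -[1+ t ])
  negative (a , s+2a≡ℓ , a[s+a]≡m) =
    (suc t + a , a) , splitting (trans (parts a (suc t)) s+2a≡ℓ) (trans (*-comm (suc t + a) a) a[s+a]≡m) ,
    trans (cong (λ z → + a ℤ.- z) (pos-+ (suc t) a)) (sub-add (+ suc t) (+ a))

-- A splitting is determined by its difference: 2a = (a + q) − (q − a).
splits-unique : ∀ {ℓ m m′ a q a′ q′} → Splits ℓ m a q → Splits ℓ m′ a′ q′ →
                + q ℤ.- + a ≡ + q′ ℤ.- + a′ → a ≡ a′
splits-unique {a = a} {q} {a′} {q′} (splitting sum _) (splitting sum′ _) diff =
  *-cancelʳ-≡ a a′ 2 (ℤP.+-injective (begin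
    + (a * 2)                          ≡⟨ twice a q ⟩
    + (a + q) ℤ.- (+ q ℤ.- + a)        ≡⟨ cong₂ (λ l z → + l ℤ.- z) (trans sum (sym sum′)) diff ⟩
    + (a′ + q′) ℤ.- (+ q′ ℤ.- + a′)    ≡⟨ sym (twice a′ q′) ⟩
    + (a′ * 2)                         ∎))
  where
  open ≡-Reasoning
  twice-ℤ : ∀ (a q : ℤ) → a ℤ.* + 2 ≡ (a ℤ.+ q) ℤ.- (q ℤ.- a)
  twice-ℤ = solve 2 (λ a q → a :* con (+ 2) := (a :+ q) :- (q :- a)) refl
    where open ℤ-Solver.+-*-Solver
  twice : ∀ a q → + (a * 2) ≡ + (a + q) ℤ.- (+ q ℤ.- + a)
  twice a q = trans (pos-* a 2) (trans (twice-ℤ (+ a) (+ q)) (cong (λ z → z ℤ.- (+ q ℤ.- + a)) (sym (pos-+ a q))))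

APointAt : ℕ → ℕ → ℕ × ℕ → Set
APointAt M ℓ (a , n) =
  Σ (0 < a) λ a>0 → (0 < n) × (a ∣ n * n) × (gcd n M ≡ 1) × (a + _/_ (n * n) a {{>-nonZero a>0}} ≡ ℓ)

-- Divisibility by a positive number has a unique proof, as the quotient is unique.
∣-irrelevant : ∀ {a m} → 0 < a → Irrelevant (a ∣ m)
∣-irrelevant {a} a>0 (divides q e) (divides q′ e′)
  with *-cancelʳ-≡ q q′ a {{>-nonZero a>0}} (trans (sym e) e′)
... | refl = cong (divides q) (≡-irrelevant e e′)

APointAt-irrelevant : ∀ {M ℓ} → IrrelevantPred (APointAt M ℓ)
APointAt-irrelevant _ (a>0 , n>0 , d , g , e) (a>0′ , n>0′ , d′ , g′ , e′)
  with <-irrelevant a>0 a>0′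
... | refl rewrite <-irrelevant n>0 n>0′ | ∣-irrelevant a>0 d d′ | ≡-irrelevant g g′ | ≡-irrelevant e e′ = refl

APointAt-dec : ∀ M ℓ x → Dec (APointAt M ℓ x)
APointAt-dec M ℓ (a , n) with 0 <? a
... | no a≯0  = no (a≯0 ∘ proj₁)
... | yes a>0 = map′ (a>0 ,_) (λ { (a>0′ , rest) → subst Rest (<-irrelevant a>0′ a>0) rest })
  ((0 <? n) ×-dec (a ∣? n * n) ×-dec (gcd n M ≟ 1) ×-dec (a + _/_ (n * n) a {{>-nonZero a>0}} ≟ ℓ))
  where
  Rest : 0 < a → Set
  Rest a>0 = (0 < n) × (a ∣ n * n) × (gcd n M ≡ 1) × (a + _/_ (n * n) a {{>-nonZero a>0}} ≡ ℓ)

divisor⇒splits : ∀ {ℓ m a} (a>0 : 0 < a) → a ∣ m → a + _/_ m a {{>-nonZero a>0}} ≡ ℓ →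
                 Splits ℓ m a (_/_ m a {{>-nonZero a>0}})
divisor⇒splits a>0 a∣m e = splitting e (m*[n/m]≡n {{>-nonZero a>0}} a∣m)

splits⇒divisor : ∀ {ℓ m a q} → 0 < m → Splits ℓ m a q →
                 Σ (0 < a) λ a>0 → (a ∣ m) × (_/_ m a {{>-nonZero a>0}} ≡ q)
splits⇒divisor {a = zero} () (splitting _ refl)
splits⇒divisor {m = m} {suc a} {q} _ (splitting _ product) =
  s≤s z≤n , a∣m , n/m≡quotient a∣m
  where
  a∣m : suc a ∣ m
  a∣m = divides q (trans (sym product) (*-comm (suc a) q))

-- APoint M ℓ lies in the box [0, ℓ] × [0, ℓ²]: a ≤ ℓ, and n ≤ n² = a·(n²/a) ≤ ℓ².
APointAt-bound : ∀ {M ℓ a n} → APointAt M ℓ (a , n) → a < suc ℓ × n < suc (ℓ * ℓ)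
APointAt-bound {ℓ = ℓ} {a} {n} (a>0 , n>0 , a∣n² , _ , e) =
  s≤s a≤ℓ , s≤s (≤-trans (m≤m*n n n {{>-nonZero n>0}})
                 (subst (_≤ ℓ * ℓ) (Splits.product (divisor⇒splits a>0 a∣n² e)) (*-mono-≤ a≤ℓ q≤ℓ)))
  where
  q : ℕ
  q = _/_ (n * n) a {{>-nonZero a>0}}
  a≤ℓ : a ≤ ℓ
  a≤ℓ = subst (a ≤_) e (m≤m+n a q)
  q≤ℓ : q ≤ ℓ
  q≤ℓ = subst (q ≤_) e (m≤n+m q a)

APoint-finite : ∀ M ℓ → Σ ℕ (HasSize (APoint M ℓ))
APoint-finite M ℓ =
  box-finite (suc ℓ) (suc (ℓ * ℓ)) APointAt-irrelevant (APointAt-dec M ℓ) APointAt-bound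

OnAxisAt : ℕ → ℕ → ℤ → Set
OnAxisAt M ℓ x = Root ℓ 0 x × (gcd 0 M ≡ 1)

-- Points (x, ±(k + 1)) of RPoint M (ℓ²), forgetting the sign of y.
OffAxisAt : ℕ → ℕ → ℕ × ℤ → Set
OffAxisAt M ℓ (k , x) = Root ℓ (suc k * suc k) x × (gcd (suc k) M ≡ 1)

RPoint-decomposition : ∀ M ℓ →
  RPoint M (ℓ * ℓ) ↔ (Σ ℤ (OnAxisAt M ℓ) ⊎ (Σ (ℕ × ℤ) (OffAxisAt M ℓ) ⊎ Σ (ℕ × ℤ) (OffAxisAt M ℓ)))
RPoint-decomposition M ℓ = mk↔ₛ′ to from to∘from from∘to
  where
  to : RPoint M (ℓ * ℓ) → Σ ℤ (OnAxisAt M ℓ) ⊎ (Σ (ℕ × ℤ) (OffAxisAt M ℓ) ⊎ Σ (ℕ × ℤ) (OffAxisAt M ℓ))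
  to ((x , + zero)   , p) = inj₁ (x , p)
  to ((x , +[1+ k ]) , p) = inj₂ (inj₁ ((k , x) , p))
  to ((x , -[1+ k ]) , p) = inj₂ (inj₂ ((k , x) , p))
  from : Σ ℤ (OnAxisAt M ℓ) ⊎ (Σ (ℕ × ℤ) (OffAxisAt M ℓ) ⊎ Σ (ℕ × ℤ) (OffAxisAt M ℓ)) → RPoint M (ℓ * ℓ)
  from (inj₁ (x , p))               = (x , + zero) , p
  from (inj₂ (inj₁ ((k , x) , p))) = (x , +[1+ k ]) , p
  from (inj₂ (inj₂ ((k , x) , p))) = (x , -[1+ k ]) , p
  to∘from : ∀ t → to (from t) ≡ t
  to∘from (inj₁ _)        = refl
  to∘from (inj₂ (inj₁ _)) = refl
  to∘from (inj₂ (inj₂ _)) = refl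
  from∘to : ∀ s → from (to s) ≡ s
  from∘to ((_ , + zero)   , _) = refl
  from∘to ((_ , +[1+ _ ]) , _) = refl
  from∘to ((_ , -[1+ _ ]) , _) = refl

on-axis-size : ∀ M ℓ → 0 < ℓ → Σ ℤ (OnAxisAt M ℓ) ↔ Fin (2 * δ₁ M)
on-axis-size M ℓ@(suc l) _ with M ≟ 1
... | no M≢1 = mk↔ₛ′ (⊥-elim ∘ M≢1 ∘ coprime) (λ ()) (λ ()) (⊥-elim ∘ M≢1 ∘ coprime)
  where
  coprime : Σ ℤ (OnAxisAt M ℓ) → M ≡ 1
  coprime (_ , _ , g) = trans (sym (gcd-identityˡ M)) g
... | yes refl = mk↔ₛ′ to from to∘from from∘to
  where
  -- both x = ℓ and x = −ℓ satisfy ℓ² = x² + 4·0, which computes to this equation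
  ±ℓ-root : + (ℓ * ℓ) ≡ + (ℓ * ℓ + 0)
  ±ℓ-root = cong +_ (sym (+-identityʳ (ℓ * ℓ)))
  root-abs≡ℓ : ∀ {x} → Root ℓ 0 x → ∣ x ∣ ≡ ℓ
  root-abs≡ℓ {x} r = square-injective (sym (trans (root-abs {ℓ} {0} x r) (+-identityʳ _)))
  to : Σ ℤ (OnAxisAt 1 ℓ) → Fin 2
  to (+ _    , _) = zero
  to (-[1+ _ ] , _) = suc zero
  from : Fin 2 → Σ ℤ (OnAxisAt 1 ℓ)
  from zero       = + ℓ , ±ℓ-root , gcd-identityˡ 1
  from (suc zero) = -[1+ l ] , ±ℓ-root , gcd-identityˡ 1
  to∘from : ∀ i → to (from i) ≡ i
  to∘from zero       = refl
  to∘from (suc zero) = refl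
  from∘to : ∀ s → from (to s) ≡ s
  from∘to (+ s      , r , _) = subset-≡ (λ _ → root-gcd-irrelevant) (cong +_ (sym (root-abs≡ℓ {+ s} r)))
  from∘to (-[1+ t ] , r , _) = subset-≡ (λ _ → root-gcd-irrelevant) (cong (λ z → -[1+ pred z ]) (sym (root-abs≡ℓ { -[1+ t ]} r)))

-- Off the axis: (k, x) ↦ (a, k + 1) where (a, q) is the splitting of ℓ with
-- product (k + 1)² and x = q − a; the inverse is (a, n) ↦ (n − 1, n²/a − a).
off-axis↔APoint : ∀ M ℓ → Σ (ℕ × ℤ) (OffAxisAt M ℓ) ↔ APoint M ℓ
off-axis↔APoint M ℓ = subset-↔ (λ _ → root-gcd-irrelevant) APointAt-irrelevant to from from∘to to∘from
  where
  to : Σ (ℕ × ℤ) (OffAxisAt M ℓ) → APoint M ℓ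
  to ((k , x) , r , g) =
    let ((a , _) , splits , _) = root⇒splits x r
        (a>0 , a∣n² , n²/a≡q) = splits⇒divisor (s≤s z≤n) splits
    in (a , suc k) , a>0 , s≤s z≤n , a∣n² , g , trans (cong (λ z → a + z) n²/a≡q) (Splits.sum splits)
  from : APoint M ℓ → Σ (ℕ × ℤ) (OffAxisAt M ℓ)
  from ((_ , zero) , _ , () , _)
  from ((a , suc k) , a>0 , _ , a∣n² , g , e) =
    (k , + (_/_ (suc k * suc k) a {{>-nonZero a>0}}) ℤ.- + a) , splits⇒root (divisor⇒splits a>0 a∣n² e) , g
  from∘to : ∀ s → proj₁ (from (to s)) ≡ proj₁ s
  from∘to ((k , x) , r , g) =
    let ((a , _) , splits , q-a≡x) = root⇒splits x r
        (_ , _ , n²/a≡q) = splits⇒divisor (s≤s z≤n) splits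
    in cong (k ,_) (trans (cong (λ z → + z ℤ.- + a) n²/a≡q) q-a≡x)
  to∘from : ∀ t → proj₁ (to (from t)) ≡ proj₁ t
  to∘from ((_ , zero) , _ , () , _)
  to∘from ((a , suc k) , a>0 , _ , a∣n² , g , e) =
    let q = _/_ (suc k * suc k) a {{>-nonZero a>0}}
        splits = divisor⇒splits a>0 a∣n² e
        (_ , splits′ , q′-a′≡q-a) = root⇒splits (+ q ℤ.- + a) (splits⇒root splits)
    in cong (_, suc k) (splits-unique splits′ splits q′-a′≡q-a)

lemma4p2 : (M ℓ : ℕ) → 0 < M → 0 < ℓ →
    Σ ℕ λ N → HasSize (APoint M ℓ) N × HasSize (RPoint M (ℓ * ℓ)) (2 * (N + δ₁ M))
lemma4p2 M ℓ _ ℓ>0 = N , APoint↔N , subst (HasSize (RPoint M (ℓ * ℓ))) (total-count (δ₁ M) N) RPoint↔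
  where
  N : ℕ
  N = proj₁ (APoint-finite M ℓ)
  APoint↔N : HasSize (APoint M ℓ) N
  APoint↔N = proj₂ (APoint-finite M ℓ)
  off-axis↔N : Σ (ℕ × ℤ) (OffAxisAt M ℓ) ↔ Fin N
  off-axis↔N = ↔-trans (off-axis↔APoint M ℓ) APoint↔N
  RPoint↔ : RPoint M (ℓ * ℓ) ↔ Fin (2 * δ₁ M + (N + N))
  RPoint↔ = ↔-trans (RPoint-decomposition M ℓ)
              (↔-trans (on-axis-size M ℓ ℓ>0 ⊎-↔ (off-axis↔N ⊎-↔ off-axis↔N))
                (↔-trans (↔-refl ⊎-↔ ↔-sym +↔⊎) (↔-sym +↔⊎)))
  total-count : ∀ δ N → 2 * δ + (N + N) ≡ 2 * (N + δ)
  total-count = solve 2 (λ δ N → con 2 :* δ :+ (N :+ N) := con 2 :* (N :+ δ)) refl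
    where open ℕ-Solver.+-*-Solver
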